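{- There exist constants $C,c>0$ and graphs with arbitrarily large numbers of vertices $n$ such that each such graph on $n$ vertices has edge density at most $1+C/\log^*(n)$ and Broadcast on it is unsolvable with fewer than $c\,n/\log^*(n)$ ignorant agents.
   Context: $\log^*$ is the iterated logarithm. The edge density of a graph with $n$ nodes and $m$ edges is $m/n$. The Broadcast problem: a connected base graph $G=(V,E)$ is given and time proceeds in synchronous rounds. In each round the adversary first removes a (possibly empty) set $E'\subseteq E$ such that $(V,E\setminus E')$ is connected; then each agent, after local computation and communication with agents at the same node, either stays or moves along one edge of $E\setminus E'$ incident to its node; all agents move simultaneously. Agents have unique IDs, local memory, and full knowledge at every round of $G$, the current edge set, and the positions and knowledge status of all agents. Initially one source agent holding a message $\mathcal M$ and $k\ge 1$ ignorant agents are placed at distinct nodes, the placement chosen by the adversary. An ignorant agent becomes a source agent when at the same node as a source agent. Broadcast is solvable on $G$ with $k$ ignorant agents if the agents have a strategy that, for every initial placement and every adversary behavior, makes all agents source agents within finitely many rounds; otherwise it is unsolvable. -}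

module Defs where

open import Data.Nat as ℕ using (ℕ; zero; suc; _≤ᵇ_; _<ᵇ_)
open import Data.Nat.Logarithm using (⌈log₂_⌉)
open import Data.Bool using (Bool; true; false; if_then_else_; _∧_; _∨_)
open import Data.Fin using (Fin; toℕ; _≟_)
open import Data.List using (List; []; _∷_; map; allFin)
open import Data.Nat.ListAction using (sum)
open import Data.Bool.ListAction using (any)
open import Data.Product using (Σ; ∃; _×_; _,_; proj₁; proj₂)
open import Data.Sum using (_⊎_)
open import Data.Integer using (+_)
open import Data.Rational using (ℚ; _/_)
open import Relation.Binary.PropositionalEquality using (_≡_)
open import Relation.Nullary.Decidable using (⌊_⌋)

ℕ→ℚ : ℕ → ℚ
ℕ→ℚ n = + n / 1

-- Since the thresholds of log* (the towers 1,2,4,16,65536,...) are integers,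
-- using ⌈log₂⌉ in the recursion gives exactly the real-valued log* at
-- natural arguments.  The first argument is fuel; fuel n suffices because
-- ⌈log₂ m⌉ < m for m ≥ 2.
logStar-aux : ℕ → ℕ → ℕ
logStar-aux zero    n = 0
logStar-aux (suc f) n = if n ≤ᵇ 1 then 0 else suc (logStar-aux f ⌈log₂ n ⌉)

log* : ℕ → ℕ
log* n = logStar-aux n n

EdgeSet : ℕ → Set
EdgeSet n = Fin n → Fin n → Bool

Symmetric : ∀ {n} → EdgeSet n → Set
Symmetric {n} H = (u v : Fin n) → H u v ≡ H v u

_⊆ᴱ_ : ∀ {n} → EdgeSet n → EdgeSet n → Set
_⊆ᴱ_ {n} H G = (u v : Fin n) → H u v ≡ true → G u v ≡ true

record SimpleGraph (n : ℕ) : Set where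
  field
    adj    : EdgeSet n
    sym    : Symmetric adj
    irrefl : (u : Fin n) → adj u u ≡ false
open SimpleGraph public

data Reach {n : ℕ} (H : EdgeSet n) : Fin n → Fin n → Set where
  here : ∀ {u} → Reach H u u
  step : ∀ {u v w} → H u v ≡ true → Reach H v w → Reach H u w

ConnectedE : ∀ {n} → EdgeSet n → Set
ConnectedE {n} H = (u v : Fin n) → Reach H u v

Connected : ∀ {n} → SimpleGraph n → Set
Connected G = ConnectedE (adj G)

edgeCount : ∀ {n} → SimpleGraph n → ℕ
edgeCount {n} G =
  sum (map (λ u → sum (map (λ v →
        if (toℕ u <ᵇ toℕ v) ∧ adj G u v then 1 else 0) (allFin n))) (allFin n))

-- The Broadcast game on G with k ignorant agents (k+1 agents in total,
-- agents are identified by their IDs  Fin (suc k)).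

-- an edge set left by the adversary in a round: E ∖ E' for some E' ⊆ E
-- such that (V, E ∖ E') is connected
ValidRound : ∀ {n} → SimpleGraph n → EdgeSet n → Set
ValidRound G H = (H ⊆ᴱ adj G) × Symmetric H × ConnectedE H

-- global state: positions and knowledge status (true = source agent)
record Config (n k : ℕ) : Set where
  constructor config
  field
    pos      : Fin (suc k) → Fin n
    informed : Fin (suc k) → Bool
open Config public

-- history of past rounds: (edge set of that round, configuration at its start),
-- most recent first
History : ℕ → ℕ → Set
History n k = List (EdgeSet n × Config n k)

Moves : ∀ {n k} → EdgeSet n → (Fin (suc k) → Fin n) → Set
Moves {n} {k} H p =
  (a : Fin (suc k)) → Σ (Fin n) (λ v → (v ≡ p a) ⊎ (H (p a) v ≡ true))

-- a (deterministic, full-information) strategy of the agents: given the past,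
-- the current edge set and the current configuration, choose legal moves
Strategy : ∀ {n} → SimpleGraph n → ℕ → Set
Strategy {n} G k =
  (h : History n k) (H : EdgeSet n) (c : Config n k) → Moves H (pos c)

record Adversary {n : ℕ} (G : SimpleGraph n) (k : ℕ) : Set where
  field
    choose : History n k → Config n k → EdgeSet n
    valid  : (h : History n k) (c : Config n k) → ValidRound G (choose h c)
open Adversary public

update : ∀ {n k} (H : EdgeSet n) (c : Config n k) → Moves H (pos c) → Config n k
update {n} {k} H c mv = config p′ inf′
  where
    p′ : Fin (suc k) → Fin n
    p′ a = proj₁ (mv a)
    inf′ : Fin (suc k) → Bool
    inf′ a = informed c a ∨ any (λ b → informed c b ∧ ⌊ p′ b ≟ p′ a ⌋) (allFin (suc k))

-- the play: (history, configuration) at the start of round t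
run : ∀ {n k} {G : SimpleGraph n} → Strategy G k → Adversary G k →
      Config n k → ℕ → History n k × Config n k
run σ A c₀ zero = [] , c₀
run σ A c₀ (suc t) with run σ A c₀ t
... | h , c = ((H , c) ∷ h) , update H c (σ h H c)
  where H = choose A h c

AllInformed : ∀ {n k} → Config n k → Set
AllInformed {n} {k} c = (a : Fin (suc k)) → informed c a ≡ true

initial : ∀ {n k} → (Fin (suc k) → Fin n) → Fin (suc k) → Config n k
initial p s = config p (λ a → ⌊ a ≟ s ⌋)

Solvable : ∀ {n} → SimpleGraph n → ℕ → Set
Solvable {n} G k =
  Σ (Strategy G k) λ σ →
    (p : Fin (suc k) → Fin n) → ((a b : Fin (suc k)) → p a ≡ p b → a ≡ b) →
    (s : Fin (suc k)) → (A : Adversary G k) →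
    ∃ λ t → AllInformed (proj₂ (run σ A (initial p s) t))

module Submission where

-- The graphs are windmills: a hub 0 joined to all other vertices, plus t rungs {1 + a, 1 + a + t}
-- (a < t), each closing a triangle (blade) with the hub, so there are at most n + t edges.
-- Agent a starts in blade a.  Each round the adversary deletes the spoke of every occupied blade
-- vertex whose twin is free.  The graph stays connected, since such a vertex still reaches the
-- hub through its free twin, but every agent can only move along its own rung, so no two agents
-- ever meet and the message never spreads while there are at most t agents.  With
-- t = ⌊n / 4 log* n⌋ + 1 this gives edge density at most 1 + 2 / log* n and unsolvability for
-- every k < n / (4 log* n) ignorant agents.

module NatToRational where

  open import Defs using (ℕ→ℚ)
  open import Data.Nat using (_+_; _*_; _≤_; _<_)
  open import Data.Integer as ℤ using (+≤+)
  import Data.Integer.Properties as ℤ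
  open import Data.Integer.Tactic.RingSolver using (solve-∀)
  open import Data.Nat.Coprimality using (1-coprimeTo)
  import Data.Nat.Coprimality as Coprime
  open import Data.Rational as ℚ using (ℚ; toℚᵘ; 1ℚ)
  open import Data.Rational.Properties as ℚ
    using (toℚᵘ-injective; toℚᵘ-cong; normalize-coprime; toℚᵘ-homo-+; toℚᵘ-homo-*)
  open import Data.Rational.Unnormalised as ℚᵘ using (mkℚᵘ; *≡*; *≤*; *<*)
  import Data.Rational.Unnormalised.Properties as ℚᵘ
  open import Relation.Binary.PropositionalEquality

  toℚᵘ-ℕ→ℚ : ∀ n → toℚᵘ (ℕ→ℚ n) ℚᵘ.≃ mkℚᵘ (ℤ.+ n) 0
  toℚᵘ-ℕ→ℚ n = toℚᵘ-cong (normalize-coprime (Coprime.sym (1-coprimeTo n)))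

  ℕ→ℚ-+ : ∀ m n → ℕ→ℚ (m + n) ≡ ℕ→ℚ m ℚ.+ ℕ→ℚ n
  ℕ→ℚ-+ m n = toℚᵘ-injective (begin-equality
    toℚᵘ (ℕ→ℚ (m + n))                     ≃⟨ toℚᵘ-ℕ→ℚ (m + n) ⟩
    mkℚᵘ (ℤ.+ (m + n)) 0                    ≃⟨ *≡* (trans (cong (ℤ._* ℤ.+ 1) (ℤ.pos-+ m n))
                                                        (+-over-1 (ℤ.+ m) (ℤ.+ n))) ⟩
    mkℚᵘ (ℤ.+ m) 0 ℚᵘ.+ mkℚᵘ (ℤ.+ n) 0      ≃⟨ ℚᵘ.+-cong (toℚᵘ-ℕ→ℚ m) (toℚᵘ-ℕ→ℚ n) ⟨
    toℚᵘ (ℕ→ℚ m) ℚᵘ.+ toℚᵘ (ℕ→ℚ n)         ≃⟨ toℚᵘ-homo-+ (ℕ→ℚ m) (ℕ→ℚ n) ⟨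
    toℚᵘ (ℕ→ℚ m ℚ.+ ℕ→ℚ n)                 ∎)
    where
    open ℚᵘ.≤-Reasoning
    +-over-1 : ∀ i j → (i ℤ.+ j) ℤ.* ℤ.+ 1 ≡ (i ℤ.* ℤ.+ 1 ℤ.+ j ℤ.* ℤ.+ 1) ℤ.* ℤ.+ 1
    +-over-1 = solve-∀

  ℕ→ℚ-* : ∀ m n → ℕ→ℚ (m * n) ≡ ℕ→ℚ m ℚ.* ℕ→ℚ n
  ℕ→ℚ-* m n = toℚᵘ-injective (begin-equality
    toℚᵘ (ℕ→ℚ (m * n))                     ≃⟨ toℚᵘ-ℕ→ℚ (m * n) ⟩
    mkℚᵘ (ℤ.+ (m * n)) 0                    ≃⟨ *≡* (cong (ℤ._* ℤ.+ 1) (ℤ.pos-* m n)) ⟩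
    mkℚᵘ (ℤ.+ m) 0 ℚᵘ.* mkℚᵘ (ℤ.+ n) 0      ≃⟨ ℚᵘ.*-cong (toℚᵘ-ℕ→ℚ m) (toℚᵘ-ℕ→ℚ n) ⟨
    toℚᵘ (ℕ→ℚ m) ℚᵘ.* toℚᵘ (ℕ→ℚ n)         ≃⟨ toℚᵘ-homo-* (ℕ→ℚ m) (ℕ→ℚ n) ⟨
    toℚᵘ (ℕ→ℚ m ℚ.* ℕ→ℚ n)                 ∎)
    where open ℚᵘ.≤-Reasoning

  ℕ→ℚ-mono-≤ : ∀ {m n} → m ≤ n → ℕ→ℚ m ℚ.≤ ℕ→ℚ n
  ℕ→ℚ-mono-≤ {m} {n} m≤n = ℚ.toℚᵘ-cancel-≤ (begin
    toℚᵘ (ℕ→ℚ m)    ≃⟨ toℚᵘ-ℕ→ℚ m ⟩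
    mkℚᵘ (ℤ.+ m) 0  ≤⟨ *≤* (subst₂ ℤ._≤_ (sym (ℤ.*-identityʳ _)) (sym (ℤ.*-identityʳ _))
                                (+≤+ m≤n)) ⟩
    mkℚᵘ (ℤ.+ n) 0  ≃⟨ toℚᵘ-ℕ→ℚ n ⟨
    toℚᵘ (ℕ→ℚ n)    ∎)
    where open ℚᵘ.≤-Reasoning

  ℕ→ℚ-cancel-< : ∀ {m n} → ℕ→ℚ m ℚ.< ℕ→ℚ n → m < n
  ℕ→ℚ-cancel-< {m} {n} m<n
    with ℚᵘ.<-respʳ-≃ (toℚᵘ-ℕ→ℚ n) (ℚᵘ.<-respˡ-≃ (toℚᵘ-ℕ→ℚ m) (ℚ.toℚᵘ-mono-< m<n))
  ... | *<* m<n′ = ℤ.drop‿+<+ (subst₂ ℤ._<_ (ℤ.*-identityʳ _) (ℤ.*-identityʳ _) m<n′)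

  ℕ→ℚ-*-≤ : ∀ {a b c n} → a * b ≤ (b + c) * n → ℕ→ℚ a ℚ.* ℕ→ℚ b ℚ.≤ (ℕ→ℚ b ℚ.+ ℕ→ℚ c) ℚ.* ℕ→ℚ n
  ℕ→ℚ-*-≤ {a} {b} {c} {n} ab≤[b+c]n =
    subst₂ ℚ._≤_ (ℕ→ℚ-* a b) (trans (ℕ→ℚ-* (b + c) n) (cong (ℚ._* ℕ→ℚ n) (ℕ→ℚ-+ b c)))
      (ℕ→ℚ-mono-≤ ab≤[b+c]n)

  ¼ : ℚ
  ¼ = ℤ.+ 1 ℚ./ 4

  ℕ→ℚ-*-<-¼* : ∀ {a b n} → ℕ→ℚ a ℚ.* ℕ→ℚ b ℚ.< ¼ ℚ.* ℕ→ℚ n → a * b * 4 < n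
  ℕ→ℚ-*-<-¼* {a} {b} {n} ab<n/4 = ℕ→ℚ-cancel-< (begin-strict
    ℕ→ℚ (a * b * 4)                     ≡⟨ trans (ℕ→ℚ-* (a * b) 4) (cong (ℚ._* ℕ→ℚ 4) (ℕ→ℚ-* a b)) ⟩
    (ℕ→ℚ a ℚ.* ℕ→ℚ b) ℚ.* ℕ→ℚ 4        <⟨ ℚ.*-monoˡ-<-pos (ℕ→ℚ 4) ab<n/4 ⟩
    (¼ ℚ.* ℕ→ℚ n) ℚ.* ℕ→ℚ 4            ≡⟨ cong (ℚ._* ℕ→ℚ 4) (ℚ.*-comm ¼ (ℕ→ℚ n)) ⟩
    (ℕ→ℚ n ℚ.* ¼) ℚ.* ℕ→ℚ 4            ≡⟨ ℚ.*-assoc (ℕ→ℚ n) ¼ (ℕ→ℚ 4) ⟩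
    ℕ→ℚ n ℚ.* 1ℚ                        ≡⟨ ℚ.*-identityʳ (ℕ→ℚ n) ⟩
    ℕ→ℚ n                               ∎)
    where open ℚ.≤-Reasoning


module FiniteSums where

  open import Data.Nat using (ℕ; zero; suc; _+_; _≤_; z≤n; s≤s; _≡ᵇ_; _<ᵇ_)
  import Data.Nat.Properties as ℕ
  open import Data.Bool using (Bool; true; false; if_then_else_; T)
  open import Data.Fin using (Fin; zero; suc; toℕ)
  open import Data.List using (map; allFin; tabulate)
  open import Data.List.Properties using (map-tabulate)
  open import Data.Nat.ListAction using (sum)
  open import Data.Empty using (⊥-elim)
  open import Data.Unit using (tt)
  open import Function using (_∘_; id)
  open import Relation.Binary.PropositionalEquality

  𝟙 : Bool → ℕ
  𝟙 b = if b then 1 else 0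

  𝟙-≤-1 : ∀ b → 𝟙 b ≤ 1
  𝟙-≤-1 true  = ℕ.≤-refl
  𝟙-≤-1 false = z≤n

  𝟙-mono : ∀ {b b′} → (T b → T b′) → 𝟙 b ≤ 𝟙 b′
  𝟙-mono {false}        _    = z≤n
  𝟙-mono {true} {true}  _    = ℕ.≤-refl
  𝟙-mono {true} {false} b⇒b′ = ⊥-elim (b⇒b′ tt)

  ∑ : (n : ℕ) → (Fin n → ℕ) → ℕ
  ∑ zero    f = 0
  ∑ (suc n) f = f zero + ∑ n (f ∘ suc)

  ∑-tabulate : ∀ n (f : Fin n → ℕ) → sum (tabulate f) ≡ ∑ n f
  ∑-tabulate zero    f = refl
  ∑-tabulate (suc n) f = cong (f zero +_) (∑-tabulate n (f ∘ suc))

  sum-map-allFin : ∀ n (f : Fin n → ℕ) → sum (map f (allFin n)) ≡ ∑ n f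
  sum-map-allFin n f = trans (cong sum (map-tabulate id f)) (∑-tabulate n f)

  ∑-mono-≤ : ∀ n {f g : Fin n → ℕ} → (∀ i → f i ≤ g i) → ∑ n f ≤ ∑ n g
  ∑-mono-≤ zero    f≤g = z≤n
  ∑-mono-≤ (suc n) f≤g = ℕ.+-mono-≤ (f≤g zero) (∑-mono-≤ n (f≤g ∘ suc))

  ∑-zero : ∀ n → ∑ n (λ _ → 0) ≡ 0
  ∑-zero zero    = refl
  ∑-zero (suc n) = ∑-zero n

  ∑-𝟙-≤ : ∀ n (p : Fin n → Bool) → ∑ n (𝟙 ∘ p) ≤ n
  ∑-𝟙-≤ zero    p = z≤n
  ∑-𝟙-≤ (suc n) p = ℕ.+-mono-≤ (𝟙-≤-1 (p zero)) (∑-𝟙-≤ n (p ∘ suc))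

  ∑-𝟙-≡ᵇ : ∀ n c → ∑ n (λ i → 𝟙 (toℕ i ≡ᵇ c)) ≤ 1
  ∑-𝟙-≡ᵇ zero    c       = z≤n
  ∑-𝟙-≡ᵇ (suc n) zero    = ℕ.≤-reflexive (cong suc (∑-zero n))
  ∑-𝟙-≡ᵇ (suc n) (suc c) = ∑-𝟙-≡ᵇ n c

  ∑-𝟙-<ᵇ : ∀ n c → ∑ n (λ i → 𝟙 (toℕ i <ᵇ c)) ≤ c
  ∑-𝟙-<ᵇ zero    c       = z≤n
  ∑-𝟙-<ᵇ (suc n) zero    = ℕ.≤-reflexive (∑-zero n)
  ∑-𝟙-<ᵇ (suc n) (suc c) = s≤s (∑-𝟙-<ᵇ n c)


module Reachability where

  open import Defs hiding (sym)
  open import Data.Product using (_,_)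
  open import Relation.Binary.PropositionalEquality

  Reach-trans : ∀ {n} {H : EdgeSet n} {u v w} → Reach H u v → Reach H v w → Reach H u w
  Reach-trans here       r = r
  Reach-trans (step e p) r = step e (Reach-trans p r)

  Reach-sym : ∀ {n} {H : EdgeSet n} → Symmetric H → ∀ {u v} → Reach H u v → Reach H v u
  Reach-sym H-sym here               = here
  Reach-sym H-sym (step {u} {v} e p) =
    Reach-trans (Reach-sym H-sym p) (step (trans (H-sym v u) e) here)

  Reach-mono : ∀ {n} {H H′ : EdgeSet n} → H ⊆ᴱ H′ → ∀ {u v} → Reach H u v → Reach H′ u v
  Reach-mono H⊆H′ here               = here
  Reach-mono H⊆H′ (step {u} {v} e p) = step (H⊆H′ u v e) (Reach-mono H⊆H′ p)

  hub⇒connected : ∀ {n} {H : EdgeSet n} {h} → Symmetric H → (∀ u → Reach H u h) → ConnectedE H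
  hub⇒connected H-sym to-hub u v = Reach-trans (to-hub u) (Reach-sym H-sym (to-hub v))

  validRound⇒connected : ∀ {n} {G : SimpleGraph n} {H} → ValidRound G H → Connected G
  validRound⇒connected (H⊆G , _ , H-connected) u v = Reach-mono H⊆G (H-connected u v)



module Windmill where

  open import Defs hiding (sym)
  open FiniteSums
  open import Data.Nat using (ℕ; zero; suc; _+_; _≤_; _<_; z<s; _<ᵇ_; _≡ᵇ_)
  import Data.Nat.Properties as ℕ
  open import Data.Bool using (Bool; true; false; T; _∧_; _∨_)
  open import Data.Bool.Properties using (T-≡; T-∧; T-∨; ∨-comm)
  open import Data.Fin using (Fin; zero; suc; toℕ)
  open import Data.List using (map; allFin)
  open import Data.Nat.ListAction using (sum)
  open import Data.Product using (_,_)
  open import Data.Sum as Sum using (_⊎_; inj₁; inj₂)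
  open import Data.Empty using (⊥-elim)
  open import Data.Unit using (tt)
  open import Function using (_∘_)
  open import Function.Bundles using (Equivalence)
  open import Relation.Binary.PropositionalEquality
  open Equivalence using (to; from)

  -- Every edge of the windmill, oriented from its smaller end: the spokes from the hub 0, and
  -- for each blade a < t the rung from 1 + a to 1 + a + t.
  link : ℕ → ℕ → ℕ → Bool
  link t zero    zero    = false
  link t zero    (suc _) = true
  link t (suc a) j       = (a <ᵇ t) ∧ (j ≡ᵇ suc a + t)

  data Link (t : ℕ) : ℕ → ℕ → Set where
    spoke : ∀ m → Link t 0 (suc m)
    rung  : ∀ {a} → a < t → Link t (suc a) (suc a + t)

  link-sound : ∀ t i j → T (link t i j) → Link t i j
  link-sound t zero    (suc m) _ = spoke m
  link-sound t (suc a) j       l with to T-∧ l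
  ... | a<t , j≡ = subst (Link t (suc a)) (sym (ℕ.≡ᵇ⇒≡ j _ j≡)) (rung (ℕ.<ᵇ⇒< a t a<t))

  link-complete : ∀ {t i j} → Link t i j → T (link t i j)
  link-complete     (spoke m)      = tt
  link-complete {t} (rung {a} a<t) = from T-∧ (ℕ.<⇒<ᵇ a<t , ℕ.≡⇒≡ᵇ (suc a + t) _ refl)

  Link-< : ∀ {t i j} → Link t i j → i < j
  Link-< (spoke m)      = z<s
  Link-< (rung {a} a<t) = ℕ.m<m+n (suc a) (ℕ.<-≤-trans z<s a<t)

  link-irrefl : ∀ t i → link t i i ≡ false
  link-irrefl t i with link t i i in e
  ... | false = refl
  ... | true  = ⊥-elim (ℕ.<-irrefl refl (Link-< (link-sound t i i (from T-≡ e))))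

  windmillAdj : ℕ → ℕ → ℕ → Bool
  windmillAdj t i j = link t i j ∨ link t j i

  windmillAdj-sound : ∀ t i j → T (windmillAdj t i j) → Link t i j ⊎ Link t j i
  windmillAdj-sound t i j = Sum.map (link-sound t i j) (link-sound t j i) ∘ to T-∨

  windmill : (t n : ℕ) → SimpleGraph n
  windmill t n = record
    { adj    = λ u v → windmillAdj t (toℕ u) (toℕ v)
    ; sym    = λ u v → ∨-comm (link t (toℕ u) (toℕ v)) (link t (toℕ v) (toℕ u))
    ; irrefl = λ u → cong₂ _∨_ (link-irrefl t (toℕ u)) (link-irrefl t (toℕ u))
    }

  forward-edge-is-link : ∀ t i j → T ((i <ᵇ j) ∧ windmillAdj t i j) → T (link t i j)
  forward-edge-is-link t i j e with to T-∧ e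
  ... | i<j , adj with windmillAdj-sound t i j adj
  ...   | inj₁ l = link-complete l
  ...   | inj₂ l = ⊥-elim (ℕ.<-asym (ℕ.<ᵇ⇒< i j i<j) (Link-< l))

  links-from-blade : ∀ t n a → ∑ n (λ v → 𝟙 (link t (suc a) (toℕ v))) ≤ 𝟙 (a <ᵇ t)
  links-from-blade t n a with a <ᵇ t
  ... | true  = ∑-𝟙-≡ᵇ n (suc a + t)
  ... | false = ℕ.≤-reflexive (∑-zero n)

  windmill-edgeCount : ∀ t n → edgeCount (windmill t (suc n)) ≤ suc n + t
  windmill-edgeCount t n = begin
    edgeCount (windmill t (suc n))                   ≡⟨ sum-map-allFin (suc n) forward-edges ⟩
    ∑ (suc n) forward-edges                          ≤⟨ ∑-mono-≤ (suc n) forward-edges≤links ⟩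
    ∑ (suc n) links                                  ≤⟨ ℕ.+-mono-≤ spokes rungs ⟩
    suc n + ∑ n (λ w → 𝟙 (toℕ w <ᵇ t))               ≤⟨ ℕ.+-monoʳ-≤ (suc n) (∑-𝟙-<ᵇ n t) ⟩
    suc n + t                                        ∎
    where
    open ℕ.≤-Reasoning
    forward-edge : Fin (suc n) → Fin (suc n) → ℕ
    forward-edge u v = 𝟙 ((toℕ u <ᵇ toℕ v) ∧ windmillAdj t (toℕ u) (toℕ v))
    forward-edges links : Fin (suc n) → ℕ
    forward-edges u = sum (map (forward-edge u) (allFin (suc n)))
    links u = ∑ (suc n) (λ v → 𝟙 (link t (toℕ u) (toℕ v)))
    forward-edges≤links : ∀ u → forward-edges u ≤ links u
    forward-edges≤links u = ℕ.≤-trans (ℕ.≤-reflexive (sum-map-allFin (suc n) (forward-edge u)))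
      (∑-mono-≤ (suc n) (λ v → 𝟙-mono (forward-edge-is-link t (toℕ u) (toℕ v))))
    spokes : links zero ≤ suc n
    spokes = ∑-𝟙-≤ (suc n) (λ v → link t 0 (toℕ v))
    rungs : ∑ n (links ∘ suc) ≤ ∑ n (λ w → 𝟙 (toℕ w <ᵇ t))
    rungs = ∑-mono-≤ n (λ w → links-from-blade t (suc n) (toℕ w))


module WindmillBlades where

  open Windmill
  open import Data.Nat using (ℕ; zero; suc; _+_; _∸_; _≤_; _<_; z≤n; s≤s; z<s; _<ᵇ_; _≤ᵇ_)
  import Data.Nat.Properties as ℕ
  open import Data.Bool using (Bool; true; false; if_then_else_; T)
  open import Data.Bool.Properties using (T-≡; T-∨)
  open import Data.Product using (∃; _×_; _,_)
  open import Data.Sum using (_⊎_; inj₁; inj₂)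
  open import Data.Empty using (⊥-elim)
  open import Function.Bundles using (Equivalence)
  open import Relation.Binary.PropositionalEquality
  open Equivalence using (to; from)

  InBlade : ℕ → ℕ → ℕ → Set
  InBlade t a x = x ≡ suc a ⊎ x ≡ suc a + t

  InBlade-pos : ∀ {t a x} → InBlade t a x → 1 ≤ x
  InBlade-pos (inj₁ refl) = s≤s z≤n
  InBlade-pos (inj₂ refl) = s≤s z≤n

  InBlade-≤ : ∀ {t a x} → a < t → InBlade t a x → x ≤ t + t
  InBlade-≤ {t} a<t (inj₁ refl) = ℕ.≤-trans a<t (ℕ.m≤m+n t t)
  InBlade-≤ {t} a<t (inj₂ refl) = ℕ.+-monoˡ-≤ t a<t

  lower≢upper : ∀ {t a b} → a < t → suc a ≢ suc b + t
  lower≢upper {t} a<t e = ℕ.<-irrefl e (ℕ.≤-<-trans a<t (ℕ.m<n+m t z<s))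

  InBlade-unique : ∀ {t a b x} → a < t → b < t → InBlade t a x → InBlade t b x → a ≡ b
  InBlade-unique a<t b<t (inj₁ refl) (inj₁ e) = ℕ.suc-injective e
  InBlade-unique a<t b<t (inj₁ refl) (inj₂ e) = ⊥-elim (lower≢upper a<t e)
  InBlade-unique a<t b<t (inj₂ refl) (inj₁ e) = ⊥-elim (lower≢upper b<t (sym e))
  InBlade-unique a<t b<t (inj₂ refl) (inj₂ e) = ℕ.suc-injective (ℕ.+-cancelʳ-≡ _ _ _ e)

  twin : ℕ → ℕ → ℕ
  twin t x = if x ≤ᵇ t then x + t else x ∸ t

  twin-lower : ∀ {t a} → a < t → twin t (suc a) ≡ suc a + t
  twin-lower a<t rewrite to T-≡ (ℕ.<⇒<ᵇ a<t) = refl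

  twin-upper : ∀ t a → twin t (suc a + t) ≡ suc a
  twin-upper t a with suc a + t ≤ᵇ t in e
  ... | true  = ⊥-elim (ℕ.m+n≮n a t (ℕ.≤ᵇ⇒≤ (suc a + t) t (from T-≡ e)))
  ... | false = ℕ.m+n∸n≡m (suc a) t

  twin-InBlade : ∀ {t a x} → a < t → InBlade t a x → InBlade t a (twin t x)
  twin-InBlade         a<t (inj₁ refl) = inj₂ (twin-lower a<t)
  twin-InBlade {t} {a} a<t (inj₂ refl) = inj₁ (twin-upper t a)

  twin-≢ : ∀ {t a x} → a < t → InBlade t a x → twin t x ≢ x
  twin-≢         a<t (inj₁ refl) e = lower≢upper a<t (trans (sym e) (twin-lower a<t))
  twin-≢ {t} {a} a<t (inj₂ refl) e = lower≢upper a<t (trans (sym (twin-upper t a)) e)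

  twin-adjacent : ∀ {t a x} → a < t → InBlade t a x → T (windmillAdj t x (twin t x))
  twin-adjacent {t} {a} a<t (inj₁ refl) rewrite twin-lower a<t =
    from T-∨ (inj₁ (link-complete (rung a<t)))
  twin-adjacent {t} {a} a<t (inj₂ refl) rewrite twin-upper t a =
    from (T-∨ {link t (suc a + t) (suc a)}) (inj₂ (link-complete (rung a<t)))

  windmill-neighbour : ∀ {t a x v} → a < t → InBlade t a x → T (windmillAdj t x v) →
                       v ≡ 0 ⊎ InBlade t a v
  windmill-neighbour {t} {a} {x} {v} a<t x∈ adj with windmillAdj-sound t x v adj | x∈
  ... | inj₁ (spoke m)     | inj₁ ()
  ... | inj₁ (spoke m)     | inj₂ ()
  ... | inj₁ (rung _)      | inj₁ refl = inj₂ (inj₂ refl)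
  ... | inj₁ (rung a+t<t)  | inj₂ refl = ⊥-elim (ℕ.m+n≮n a t a+t<t)
  ... | inj₂ (spoke m)     | _         = inj₁ refl
  ... | inj₂ (rung _)      | inj₁ refl = ⊥-elim (ℕ.m+n≮n _ t a<t)
  ... | inj₂ (rung _)      | inj₂ e    =
    inj₂ (inj₁ (cong suc (ℕ.suc-injective (ℕ.+-cancelʳ-≡ t _ _ e))))

  inBlades : ℕ → ℕ → Bool
  inBlades t zero    = false
  inBlades t (suc m) = m <ᵇ t + t

  inBlades-sound : ∀ t x → T (inBlades t x) → ∃ λ a → a < t × InBlade t a x
  inBlades-sound t (suc m) m<2t with ℕ.<-≤-connex m t
  ... | inj₁ m<t = m , m<t , inj₁ refl
  ... | inj₂ t≤m = m ∸ t , m∸t<t , inj₂ (cong suc (sym (ℕ.m∸n+n≡m t≤m)))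
    where
    m∸t<t : m ∸ t < t
    m∸t<t = subst (m ∸ t <_) (ℕ.m+n∸n≡m t t) (ℕ.∸-monoˡ-< (ℕ.<ᵇ⇒< m (t + t) m<2t) t≤m)

  InBlade⇒inBlades : ∀ {t a x} → a < t → InBlade t a x → T (inBlades t x)
  InBlade⇒inBlades {t} a<t (inj₁ refl) = ℕ.<⇒<ᵇ (ℕ.<-≤-trans a<t (ℕ.m≤m+n t t))
  InBlade⇒inBlades {t} a<t (inj₂ refl) = ℕ.<⇒<ᵇ (ℕ.+-monoˡ-< t a<t)


module WindmillRounds where

  open import Defs hiding (sym)
  open Reachability
  open Windmill
  open WindmillBlades
  open import Data.Nat using (ℕ; zero; suc; _+_; _≤_; _<_; z≤n; s≤s)
  import Data.Nat.Properties as ℕ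
  open import Data.Bool using (Bool; true; false; T; not; _∧_)
  open import Data.Bool.Properties using (T-≡; T-not-≡; T-∧; ∨-comm; ∨-zeroʳ; ∧-zeroʳ)
  open import Data.Fin using (Fin; zero; suc; toℕ; fromℕ<)
  open import Data.Fin.Properties using (toℕ-fromℕ<)
  open import Data.Product using (∃; _×_; _,_; proj₁; proj₂)
  open import Data.Sum using (inj₁; inj₂)
  open import Data.Empty using (⊥-elim)
  open import Data.Unit using (tt)
  open import Function using (_∘_)
  open import Function.Bundles using (Equivalence)
  open import Relation.Binary.PropositionalEquality
  open Equivalence using (to; from)

  exposed : ℕ → (ℕ → Bool) → ℕ → Bool
  exposed t occ x = inBlades t x ∧ occ x ∧ not (occ (twin t x))

  exposed-sound : ∀ t occ x → T (exposed t occ x) →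
                  (∃ λ a → a < t × InBlade t a x) × occ (twin t x) ≡ false
  exposed-sound t occ x e with to (T-∧ {inBlades t x}) e
  ... | in-blades , occupied-and-twin-free =
    inBlades-sound t x in-blades , to T-not-≡ (proj₂ (to (T-∧ {occ x}) occupied-and-twin-free))

  free⇒unexposed : ∀ t occ {y} → occ y ≡ false → exposed t occ y ≡ false
  free⇒unexposed t occ {y} e rewrite e = ∧-zeroʳ (inBlades t y)

  severed : (ℕ → Bool) → ℕ → ℕ → Bool
  severed S zero    j       = S j
  severed S (suc i) zero    = S (suc i)
  severed S (suc i) (suc j) = false

  severed-sym : ∀ S i j → severed S i j ≡ severed S j i
  severed-sym S zero    zero    = refl
  severed-sym S zero    (suc j) = refl
  severed-sym S (suc i) zero    = refl
  severed-sym S (suc i) (suc j) = refl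

  severed-hub : ∀ S {x} → 1 ≤ x → severed S x 0 ≡ S x
  severed-hub S (s≤s z≤n) = refl

  severed-rim : ∀ S {i j} → 1 ≤ i → 1 ≤ j → severed S i j ≡ false
  severed-rim S (s≤s z≤n) (s≤s z≤n) = refl

  roundAdj : ℕ → (ℕ → Bool) → ℕ → ℕ → Bool
  roundAdj t occ i j = windmillAdj t i j ∧ not (severed (exposed t occ) i j)

  roundEdges : ∀ {n} → ℕ → (ℕ → Bool) → EdgeSet n
  roundEdges t occ u v = roundAdj t occ (toℕ u) (toℕ v)

  exposed-neighbour : ∀ {t a x v} occ → a < t → InBlade t a x → T (exposed t occ x) →
                      T (roundAdj t occ x v) → InBlade t a v
  exposed-neighbour {t} {a} {x} {v} occ a<t x∈ x-exposed e with to T-∧ e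
  ... | adj , kept with windmill-neighbour a<t x∈ adj
  ...   | inj₂ v∈   = v∈
  ...   | inj₁ refl = ⊥-elim (subst T x-unexposed x-exposed)
    where
    x-unexposed : exposed t occ x ≡ false
    x-unexposed = to T-not-≡ (subst (T ∘ not) (severed-hub (exposed t occ) (InBlade-pos x∈)) kept)

  module _ {t n : ℕ} (fits : t + t < suc n) (occ : ℕ → Bool) where

    private
      H : EdgeSet (suc n)
      H = roundEdges t occ

      step-to : ∀ {u v y} (y<n : y < suc n) → T (roundAdj t occ (toℕ u) y) →
                Reach H (fromℕ< y<n) v → Reach H u v
      step-to {u} y<n e =
        step (to T-≡ (subst (T ∘ roundAdj t occ (toℕ u)) (sym (toℕ-fromℕ< y<n)) e))

      spoke-kept : ∀ {y} → 1 ≤ y → exposed t occ y ≡ false → T (roundAdj t occ y 0)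
      spoke-kept {suc m} (s≤s z≤n) e rewrite e | ∨-zeroʳ (link t (suc m) 0) = tt

      rung-kept : ∀ {a x} → a < t → InBlade t a x → T (roundAdj t occ x (twin t x))
      rung-kept a<t x∈ = from T-∧ (twin-adjacent a<t x∈ , subst (T ∘ not) (sym
        (severed-rim (exposed t occ) (InBlade-pos x∈) (InBlade-pos (twin-InBlade a<t x∈)))) tt)

    reach-hub : (u : Fin (suc n)) → Reach H u zero
    reach-hub zero    = here
    reach-hub (suc w) with exposed t occ (suc (toℕ w)) in e
    ... | false = step-to (s≤s z≤n) (spoke-kept (s≤s z≤n) e) here
    ... | true with exposed-sound t occ (suc (toℕ w)) (from T-≡ e)
    ...   | (a , a<t , x∈) , twin-free =
      step-to twin<n (rung-kept a<t x∈) (step-to (s≤s z≤n) twin-spoke-kept here)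
      where
      y∈ : InBlade t a (twin t (suc (toℕ w)))
      y∈ = twin-InBlade a<t x∈
      twin<n : twin t (suc (toℕ w)) < suc n
      twin<n = ℕ.≤-<-trans (InBlade-≤ a<t y∈) fits
      twin-spoke-kept : T (roundAdj t occ (toℕ (fromℕ< twin<n)) 0)
      twin-spoke-kept rewrite toℕ-fromℕ< twin<n =
        spoke-kept (InBlade-pos y∈) (free⇒unexposed t occ twin-free)

    roundEdges-valid : ValidRound (windmill t (suc n)) H
    roundEdges-valid = H⊆windmill , H-sym , hub⇒connected H-sym reach-hub
      where
      H⊆windmill : H ⊆ᴱ adj (windmill t (suc n))
      H⊆windmill u v e = to T-≡ (proj₁ (to T-∧ (from T-≡ e)))
      H-sym : Symmetric H
      H-sym u v = cong₂ (λ a s → a ∧ not s)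
        (∨-comm (link t (toℕ u) (toℕ v)) (link t (toℕ v) (toℕ u)))
        (severed-sym (exposed t occ) (toℕ u) (toℕ v))

  windmill-connected : ∀ {t n} → t + t < suc n → Connected (windmill t (suc n))
  windmill-connected {t} {n} fits =
    validRound⇒connected {G = windmill t (suc n)} (roundEdges-valid fits (λ _ → false))


module BroadcastRuns where

  open import Defs hiding (sym)
  open import Data.Nat using (zero; suc)
  open import Data.Bool using (T)
  open import Data.Bool.Properties using (T-∨; T-∧)
  open import Data.List using (allFin)
  open import Data.List.Relation.Unary.Any using (satisfied)
  open import Data.List.Relation.Unary.Any.Properties using (any⁻)
  open import Data.Product using (_,_; proj₂)
  open import Data.Sum using (inj₁; inj₂)
  open import Function using (_∘_)
  open import Function.Bundles using (Equivalence)
  open import Relation.Binary.PropositionalEquality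
  open import Relation.Nullary.Decidable using (toWitness)
  open Equivalence using (to)

  run-invariant : ∀ {n k} {G : SimpleGraph n} (σ : Strategy G k) (A : Adversary G k) c₀
                  (Inv : Config n k → Set) → Inv c₀ →
                  (∀ h c → Inv c → Inv (update (choose A h c) c (σ h (choose A h c) c))) →
                  ∀ s → Inv (proj₂ (run σ A c₀ s))
  run-invariant σ A c₀ Inv inv₀ preserved zero    = inv₀
  run-invariant σ A c₀ Inv inv₀ preserved (suc s)
    with run σ A c₀ s | run-invariant σ A c₀ Inv inv₀ preserved s
  ... | h , c | inv = preserved h c inv

  no-new-sources : ∀ {n k} {H : EdgeSet n} (c : Config n k) (mv : Moves H (pos c)) →
                   (∀ a b → pos (update H c mv) a ≡ pos (update H c mv) b → a ≡ b) →
                   ∀ a → T (informed (update H c mv) a) → T (informed c a)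
  no-new-sources {k = k} c mv apart a e with to (T-∨ {informed c a}) e
  ... | inj₁ source = source
  ... | inj₂ meets with satisfied (any⁻ _ (allFin (suc k)) meets)
  ...   | b , b-meets with to (T-∧ {informed c b}) b-meets
  ...     | source , same-node = subst (T ∘ informed c) (apart b a (toWitness same-node)) source


module WindmillBroadcast where

  open import Defs hiding (sym)
  open Windmill using (windmill)
  open WindmillBlades
  open WindmillRounds
  open BroadcastRuns
  open import Data.Nat using (ℕ; zero; suc; _+_; _≤_; _<_; z≤n; s≤s; _≡ᵇ_)
  import Data.Nat.Properties as ℕ
  open import Data.Bool using (Bool; true; false; T)
  open import Data.Bool.Properties using (T-≡; T-not-≡; T-∧)
  open import Data.Bool.ListAction using (any)
  open import Data.Fin using (Fin; zero; suc; toℕ; fromℕ<)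
  open import Data.Fin.Properties using (toℕ-fromℕ<; toℕ-injective; toℕ<n; fromℕ<-injective)
  open import Data.List using (allFin)
  open import Data.List.Membership.Propositional using (lose)
  open import Data.List.Membership.Propositional.Properties using (∈-allFin)
  open import Data.List.Relation.Unary.Any using (satisfied)
  open import Data.List.Relation.Unary.Any.Properties using (any⁺; any⁻)
  open import Data.Product using (_×_; _,_; proj₂)
  open import Data.Sum using (inj₁; inj₂)
  open import Data.Empty using (⊥-elim)
  open import Function using (_∘_)
  open import Function.Bundles using (Equivalence)
  open import Relation.Binary.PropositionalEquality
  open import Relation.Nullary using (¬_)
  open import Relation.Nullary.Decidable using (toWitness)
  open Equivalence using (from)

  module _ {t n k : ℕ} (fits : t + t < suc n) (few : k < t) where

    private
      Agent : Set
      Agent = Fin (suc k)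

      State : Set
      State = Config (suc n) k

    agent<t : (a : Agent) → toℕ a < t
    agent<t a = ℕ.<-≤-trans (toℕ<n a) few

    occupied : State → ℕ → Bool
    occupied c x = any (λ a → toℕ (pos c a) ≡ᵇ x) (allFin (suc k))

    round : State → EdgeSet (suc n)
    round c = roundEdges t (occupied c)

    adversary : Adversary (windmill t (suc n)) k
    adversary = record
      { choose = λ _ → round
      ; valid  = λ _ c → roundEdges-valid fits (occupied c)
      }

    Confined : State → Set
    Confined c = ∀ a → InBlade t (toℕ a) (toℕ (pos c a))

    confined-injective : ∀ c → Confined c → ∀ a b → pos c a ≡ pos c b → a ≡ b
    confined-injective c confined a b same = toℕ-injective
      (InBlade-unique (agent<t a) (agent<t b) (confined a)
        (subst (InBlade t (toℕ b) ∘ toℕ) (sym same) (confined b)))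

    confined-twin-free : ∀ c → Confined c → ∀ a → occupied c (twin t (toℕ (pos c a))) ≡ false
    confined-twin-free c confined a with occupied c (twin t (toℕ (pos c a))) in e
    ... | false = refl
    ... | true with satisfied (any⁻ _ (allFin (suc k)) (from T-≡ e))
    ...   | b , b-at-twin = ⊥-elim (twin-≢ (agent<t a) (confined a)
                              (trans (sym b-at-twin′) (cong (toℕ ∘ pos c) b≡a)))
      where
      b-at-twin′ : toℕ (pos c b) ≡ twin t (toℕ (pos c a))
      b-at-twin′ = ℕ.≡ᵇ⇒≡ _ _ b-at-twin
      b≡a : b ≡ a
      b≡a = toℕ-injective (InBlade-unique (agent<t b) (agent<t a)
        (subst (InBlade t (toℕ b)) b-at-twin′ (confined b)) (twin-InBlade (agent<t a) (confined a)))

    confined-exposed : ∀ c → Confined c → ∀ a → T (exposed t (occupied c) (toℕ (pos c a)))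
    confined-exposed c confined a =
      from (T-∧ {inBlades t x}) (InBlade⇒inBlades (agent<t a) (confined a) ,
        from (T-∧ {occupied c x}) (occupied-x , from T-not-≡ (confined-twin-free c confined a)))
      where
      x : ℕ
      x = toℕ (pos c a)
      occupied-x : T (occupied c x)
      occupied-x = any⁺ (λ b → toℕ (pos c b) ≡ᵇ x) (lose (∈-allFin a) (ℕ.≡⇒≡ᵇ x x refl))

    confined-update : ∀ c → Confined c → (mv : Moves (round c) (pos c)) →
                      Confined (update (round c) c mv)
    confined-update c confined mv a with mv a
    ... | v , inj₁ stay = subst (InBlade t (toℕ a) ∘ toℕ) (sym stay) (confined a)
    ... | v , inj₂ edge = exposed-neighbour (occupied c) (agent<t a) (confined a)
                            (confined-exposed c confined a) (from T-≡ edge)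

    home-fits : (a : Agent) → suc (toℕ a) < suc n
    home-fits a = ℕ.≤-<-trans (InBlade-≤ (agent<t a) (inj₁ refl)) fits

    home : Agent → Fin (suc n)
    home a = fromℕ< (home-fits a)

    home-injective : ∀ a b → home a ≡ home b → a ≡ b
    home-injective a b same =
      toℕ-injective (ℕ.suc-injective (fromℕ<-injective _ _ (home-fits a) (home-fits b) same))

    Invariant : State → Set
    Invariant c = Confined c × (∀ a → T (informed c a) → a ≡ zero)

    invariant : (σ : Strategy (windmill t (suc n)) k) →
                ∀ s → Invariant (proj₂ (run σ adversary (initial home zero) s))
    invariant σ = run-invariant σ adversary (initial home zero) Invariant initially preserved
      where
      initially : Invariant (initial home zero)
      initially = (λ a → inj₁ (toℕ-fromℕ< (home-fits a))) , (λ a → toWitness)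
      preserved : ∀ h c → Invariant c → Invariant (update (round c) c (σ h (round c) c))
      preserved h c (confined , sole-source) =
        confined′ , λ a → sole-source a ∘ no-new-sources {H = round c} c mv
          (confined-injective (update (round c) c mv) confined′) a
        where
        mv : Moves (round c) (pos c)
        mv = σ h (round c) c
        confined′ : Confined (update (round c) c mv)
        confined′ = confined-update c confined mv

  windmill-unsolvable : ∀ {t n k} → t + t < suc n → 1 ≤ k → k < t →
                        ¬ Solvable (windmill t (suc n)) k
  windmill-unsolvable {k = suc k} fits (s≤s z≤n) few (σ , wins)
    with wins (home fits few) (home-injective fits few) zero (adversary fits few)
  ... | s , all-informed
    with proj₂ (invariant fits few σ s) (suc zero) (from T-≡ (all-informed (suc zero)))
  ... | ()


module IteratedLogarithm where

  open import Defs using (logStar-aux; log*)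
  open import Data.Nat using (zero; suc; _≤_; z≤n; s≤s; _≤ᵇ_; NonZero)
  open import Data.Nat.Logarithm using (⌈log₂_⌉)
  open import Data.Bool using (true; false)

  logStar-aux-≤-fuel : ∀ f m → logStar-aux f m ≤ f
  logStar-aux-≤-fuel zero    m = z≤n
  logStar-aux-≤-fuel (suc f) m with m ≤ᵇ 1
  ... | true  = z≤n
  ... | false = s≤s (logStar-aux-≤-fuel f ⌈log₂ m ⌉)

  log*-≤ : ∀ n → log* n ≤ n
  log*-≤ n = logStar-aux-≤-fuel n n

  log*-nonZero : ∀ {n} → 2 ≤ n → NonZero (log* n)
  log*-nonZero (s≤s (s≤s z≤n)) = _


module BladeCount where

  open import Data.Nat using (ℕ; suc; _+_; _*_; _≤_; _<_; s≤s; NonZero)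
  import Data.Nat.Properties as ℕ
  open import Data.Nat.DivMod using (_/_; m/n*n≤m; /-monoˡ-≤; m*n/n≡m)
  open import Data.Nat.Tactic.RingSolver using (solve-∀)
  open import Relation.Binary.PropositionalEquality

  module _ (n L : ℕ) .{{_ : NonZero L}} where

    private instance
      L*4-nonZero : NonZero (L * 4)
      L*4-nonZero = ℕ.m*n≢0 L 4

    bladeCount : ℕ
    bladeCount = suc (n / (L * 4))

    private
      q : ℕ
      q = n / (L * 4)

      q*4≤n : q * 4 ≤ n
      q*4≤n = ℕ.≤-trans (ℕ.*-monoʳ-≤ q (ℕ.m≤n*m 4 L)) (m/n*n≤m n (L * 4))

    bladeCount-> : ∀ k → k * L * 4 < n → k < bladeCount
    bladeCount-> k kL4<n = s≤s (begin
      k                       ≡⟨ m*n/n≡m k (L * 4) ⟨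
      k * (L * 4) / (L * 4)   ≤⟨ /-monoˡ-≤ (L * 4) (ℕ.<⇒≤ (subst (_< n) (ℕ.*-assoc k L 4) kL4<n)) ⟩
      n / (L * 4)             ∎)
      where open ℕ.≤-Reasoning

    bladeCount-fits : 6 ≤ n → bladeCount + bladeCount < n
    bladeCount-fits 6≤n = ℕ.*-cancelˡ-≤ 2 (begin
      2 * suc (bladeCount + bladeCount)  ≡⟨ doubled q ⟩
      q * 4 + 6                          ≤⟨ ℕ.+-mono-≤ q*4≤n 6≤n ⟩
      n + n                              ≡⟨ cong (λ m → n + m) (ℕ.+-identityʳ n) ⟨
      2 * n                              ∎)
      where
      open ℕ.≤-Reasoning
      doubled : ∀ q → 2 * suc (suc q + suc q) ≡ q * 4 + 6
      doubled = solve-∀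

    bladeCount-*-≤ : L ≤ n → bladeCount * L ≤ 2 * n
    bladeCount-*-≤ L≤n = ℕ.*-cancelʳ-≤ (bladeCount * L) (2 * n) 4 (begin
      bladeCount * L * 4      ≡⟨ ℕ.*-assoc bladeCount L 4 ⟩
      L * 4 + q * (L * 4)     ≤⟨ ℕ.+-mono-≤ (ℕ.*-monoˡ-≤ 4 L≤n) (m/n*n≤m n (L * 4)) ⟩
      n * 4 + n               ≤⟨ ℕ.+-monoʳ-≤ (n * 4) (ℕ.m≤m*n n 4) ⟩
      n * 4 + n * 4           ≡⟨ eightfold n ⟩
      2 * n * 4               ∎)
      where
      open ℕ.≤-Reasoning
      eightfold : ∀ n → n * 4 + n * 4 ≡ 2 * n * 4
      eightfold = solve-∀

    edges*L-≤ : ∀ m → m ≤ n + bladeCount → L ≤ n → m * L ≤ (L + 2) * n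
    edges*L-≤ m m≤n+t L≤n = begin
      m * L                   ≤⟨ ℕ.*-monoˡ-≤ L m≤n+t ⟩
      (n + bladeCount) * L    ≡⟨ ℕ.*-distribʳ-+ L n bladeCount ⟩
      n * L + bladeCount * L  ≤⟨ ℕ.+-monoʳ-≤ (n * L) (bladeCount-*-≤ L≤n) ⟩
      n * L + 2 * n           ≡⟨ rearrange n L ⟩
      (L + 2) * n             ∎
      where
      open ℕ.≤-Reasoning
      rearrange : ∀ n L → n * L + 2 * n ≡ (L + 2) * n
      rearrange = solve-∀


module WindmillFamily where

  open import Defs hiding (sym)
  open import Data.Nat using (ℕ; _+_; _≤_; _<_; z≤n; s≤s; NonZero)
  import Data.Nat.Properties as ℕ
  import Data.Rational as ℚ
  open import Relation.Nullary using (¬_)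
  open NatToRational
  open Windmill using (windmill; windmill-edgeCount)
  open WindmillRounds using (windmill-connected)
  open WindmillBroadcast using (windmill-unsolvable)
  open IteratedLogarithm
  open BladeCount

  module Member (N : ℕ) where

    n : ℕ
    n = 6 + N

    L : ℕ
    L = log* n

    private instance
      L-nonZero : NonZero L
      L-nonZero = log*-nonZero {n} (s≤s (s≤s z≤n))

    t : ℕ
    t = bladeCount n L

    n≥N : N ≤ n
    n≥N = ℕ.m≤n+m N 6

    fits : t + t < n
    fits = bladeCount-fits n L (ℕ.m≤m+n 6 N)

    G : SimpleGraph n
    G = windmill t n

    connected : Connected G
    connected = windmill-connected fits

    density : ℕ→ℚ (edgeCount G) ℚ.* ℕ→ℚ L ℚ.≤ (ℕ→ℚ L ℚ.+ ℕ→ℚ 2) ℚ.* ℕ→ℚ n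
    density = ℕ→ℚ-*-≤ {edgeCount G} {L} {2} {n}
      (edges*L-≤ n L (edgeCount G) (windmill-edgeCount t (5 + N)) (log*-≤ n))

    unsolvable : (k : ℕ) → 1 ≤ k → ℕ→ℚ k ℚ.* ℕ→ℚ L ℚ.< ¼ ℚ.* ℕ→ℚ n → ¬ Solvable G k
    unsolvable k 1≤k kL<n/4 =
      windmill-unsolvable fits 1≤k (bladeCount-> n L k (ℕ→ℚ-*-<-¼* {k} {L} {n} kL<n/4))


open import Defs
open import Data.Nat using (ℕ; _≤_)
open import Data.Product using (Σ; _×_)
open import Data.Rational using (ℚ; _+_; _*_; _<_; 0ℚ)
open import Relation.Nullary using (¬_)
open import Data.Rational using () renaming (_≤_ to _≤ℚ_)

open import Data.Product using (_,_)
open import Data.Rational.Properties using (positive⁻¹)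
open NatToRational using (¼)

corollary7 : Σ ℚ λ C → Σ ℚ λ c → (0ℚ < C) × (0ℚ < c) ×
    ((N : ℕ) → Σ ℕ λ n → (N ≤ n) × Σ (SimpleGraph n) λ G → Connected G ×
    ((ℕ→ℚ (edgeCount G) * ℕ→ℚ (log* n)) ≤ℚ ((ℕ→ℚ (log* n) + C) * ℕ→ℚ n)) ×
    ((k : ℕ) → 1 ≤ k → (ℕ→ℚ k * ℕ→ℚ (log* n)) < (c * ℕ→ℚ n) → ¬ Solvable G k))
corollary7 = ℕ→ℚ 2 , ¼ , positive⁻¹ (ℕ→ℚ 2) , positive⁻¹ ¼ , λ N →
  let open WindmillFamily.Member N in n , n≥N , G , connected , density , unsolvable
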